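{- Let $n\ge2$ and define, for bisubsets $S|T$ of $[n]$ (and also for $\emptyset|[n]$ and $[n]|\emptyset$), $\Pi(S|T)=-\big(|S|+|S\setminus T|\big)\cdot\big(|T|+|T\setminus S|\big)$. Then $\Pi$ strictly satisfies all supermodular and up-down inequalities: $I_{\mathsf{B}}(\Pi)>0$ for every bisequence $\mathsf{B}$ of either type.
   Context: A bisequence of $[n]$ is a sequence of nonempty subsets of $[n]$ such that every element lies in at least one and at most two parts and some element lies in exactly one part. A bisubset is a bisequence $S|T$ with two parts. (A) Supermodular inequalities: for a bisequence $\mathsf{B}$ with $2n-2$ parts, all singletons except one part $\{i,j\}$ ($i\ne j$), let $S$ be the union of the parts before $\{i,j\}$ and $T$ the union of those after; $I_{\mathsf{B}}(h)=h(S|T\cup\{i,j\})+h(S\cup\{i,j\}|T)-h(S\cup\{i\}|T\cup\{j\})-h(S\cup\{j\}|T\cup\{i\})$. (B) Up-down inequalities: for a bisequence $\mathsf{B}$ with $2n-2$ singleton parts (so exactly two elements appear once), let $\overline{\mathsf{B}}=c_1|\cdots|c_{2n}$ be obtained by replacing each once-occurring element by two consecutive copies; call the first occurrence of each element unbarred and the second barred. For $1\le m\le 2n-1$ let $S_m=\{c_1,\dots,c_m\}$, $T_m=\{c_{m+1},\dots,c_{2n}\}$; $m$ is an up position if $c_m$ is unbarred and $c_{m+1}$ barred, a down position if $c_m$ barred and $c_{m+1}$ unbarred. $I_{\mathsf{B}}(h)=\sum_{m\text{ down}}h(S_m|T_m)-\sum_{m\text{ up}}h(S_m|T_m)$. 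-}

module Defs where

open import Data.Nat as ℕ using (ℕ; zero; suc)
open import Data.Integer as ℤ using (ℤ; +_; _-_; -_; _*_; _>_)
open import Data.Fin using (Fin)
open import Data.Fin.Properties using (_≟_)
open import Data.Fin.Subset using (Subset; ⁅_⁆; _∪_; _─_; ∣_∣; Nonempty; ⊥)
open import Data.Fin.Subset.Properties using (_∈?_)
open import Data.Bool using (Bool; true; false; if_then_else_)
open import Data.List using (List; []; _∷_; _++_; [_]; length; filter; map; foldr)
open import Data.List.Relation.Unary.All using (All)
open import Data.Product using (_×_; _,_; ∃)
open import Relation.Nullary using (¬_; ⌊_⌋)
open import Relation.Binary.PropositionalEquality using (_≡_)

-- A set function on pairs of subsets of [n] (used on bisubsets S|T,
-- and on ∅|[n], [n]|∅), with integer values.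
SetFn : ℕ → Set
SetFn n = Subset n → Subset n → ℤ

Π : ∀ {n} → SetFn n
Π S T = - ((+ (∣ S ∣ ℕ.+ ∣ S ─ T ∣)) * (+ (∣ T ∣ ℕ.+ ∣ T ─ S ∣)))

occ : ∀ {n} → Fin n → List (Subset n) → ℕ
occ x Ps = length (filter (x ∈?_) Ps)

IsBisequence : ∀ n → List (Subset n) → Set
IsBisequence n Ps =
  All Nonempty Ps
  × (∀ x → 1 ℕ.≤ occ x Ps × occ x Ps ℕ.≤ 2)
  × ∃ λ x → occ x Ps ≡ 1

setOf : ∀ {n} → List (Fin n) → Subset n
setOf = foldr (λ x S → ⁅ x ⁆ ∪ S) ⊥

-- (A) Supermodular inequalities.
-- The bisequence  ⁅a₁⁆|…|⁅a_k⁆|{i,j}|⁅b₁⁆|…|⁅b_l⁆  is encoded by the lists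
-- L₁ = a₁…a_k, L₂ = b₁…b_l and the elements i, j.

smParts : ∀ {n} → List (Fin n) → Fin n → Fin n → List (Fin n) → List (Subset n)
smParts L₁ i j L₂ = map ⁅_⁆ L₁ ++ [ ⁅ i ⁆ ∪ ⁅ j ⁆ ] ++ map ⁅_⁆ L₂

IsSupermodularB : ∀ n → List (Fin n) → Fin n → Fin n → List (Fin n) → Set
IsSupermodularB n L₁ i j L₂ =
  ¬ (i ≡ j)
  × IsBisequence n (smParts L₁ i j L₂)
  × length (smParts L₁ i j L₂) ≡ 2 ℕ.* n ℕ.∸ 2

I-sm : ∀ {n} → SetFn n → List (Fin n) → Fin n → Fin n → List (Fin n) → ℤ
I-sm h L₁ i j L₂ =
  ((h S (T ∪ ij) ℤ.+ h (S ∪ ij) T) - h (S ∪ ⁅ i ⁆) (T ∪ ⁅ j ⁆)) - h (S ∪ ⁅ j ⁆) (T ∪ ⁅ i ⁆)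
  where
  S = setOf L₁
  T = setOf L₂
  ij = ⁅ i ⁆ ∪ ⁅ j ⁆

-- (B) Up-down inequalities.
-- The bisequence ⁅c₁⁆|…|⁅c_{2n-2}⁆ is encoded by the list c₁…c_{2n-2}.

IsUpDownB : ∀ n → List (Fin n) → Set
IsUpDownB n c = IsBisequence n (map ⁅_⁆ c) × length c ≡ 2 ℕ.* n ℕ.∸ 2

count : ∀ {n} → Fin n → List (Fin n) → ℕ
count x L = length (filter (x ≟_) L)

elem : ∀ {n} → Fin n → List (Fin n) → Bool
elem x [] = false
elem x (y ∷ ys) = if ⌊ x ≟ y ⌋ then true else elem x ys

-- B̄ with barring: each entry is (element, barred?).  `full` is the whole
-- list c (to know which elements occur once), `seen` the elements already read.
-- A once-occurring element x is replaced by x (unbarred), x (barred);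
-- otherwise an entry is barred iff it is the second occurrence.
expand : ∀ {n} → List (Fin n) → List (Fin n) → List (Fin n) → List (Fin n × Bool)
expand full seen [] = []
expand full seen (x ∷ xs) with count x full ℕ.≟ 1
... | Relation.Nullary.yes _ = (x , false) ∷ (x , true) ∷ expand full (x ∷ seen) xs
... | Relation.Nullary.no _  = (x , elem x seen) ∷ expand full (x ∷ seen) xs

barSeq : ∀ {n} → List (Fin n) → List (Fin n × Bool)
barSeq c = expand c [] c

elems : ∀ {n} → List (Fin n × Bool) → List (Fin n)
elems = map (λ { (x , _) → x })

-- contribution of position m with c_m = a, c_{m+1} = b, S_m = S, T_m = T
contrib : ∀ {n} → SetFn n → Bool → Bool → Subset n → Subset n → ℤ
contrib h false true  S T = - h S T   -- up position
contrib h true  false S T = h S T     -- down position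
contrib h _     _     S T = + 0

-- sum over positions m; `pre` = c₁…c_{m-1}, current list = c_m c_{m+1} …
udSum : ∀ {n} → SetFn n → List (Fin n × Bool) → List (Fin n × Bool) → ℤ
udSum h pre [] = + 0
udSum h pre (a ∷ []) = + 0
udSum h pre ((x , ba) ∷ (y , bb) ∷ rest) =
  contrib h ba bb (setOf (elems (pre ++ [ (x , ba) ]))) (setOf (elems ((y , bb) ∷ rest)))
  ℤ.+ udSum h (pre ++ [ (x , ba) ]) ((y , bb) ∷ rest)

I-ud : ∀ {n} → SetFn n → List (Fin n) → ℤ
I-ud h c = udSum h [] (barSeq c)

-- Write a(X|Y) = |X| + |X ∖ Y|, a sum over the points x of a weight depending only on whether
-- x ∈ X and x ∈ Y, so that Π(S|T) = -a(S|T)·a(T|S).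
--
-- Supermodular inequalities: with A = a(S|T ∪ {i,j}) and B = a(T|S ∪ {i,j}), each of the eight
-- weights involved is A or B plus some of the gains gᵢ, gⱼ of moving i or j to the other side,
-- and I_B(Π) = 2·gᵢ·gⱼ. Both gains are at least 1 because i and j do not lie in both S and T.
--
-- Up-down inequalities: in B̄ every element occurs twice, so a(S_m|T_m) = m and
-- a(T_m|S_m) = 2n - m. Reading unbarred entries as up steps and barred ones as down steps,
-- up positions are the peaks and down positions the valleys of a lattice path, and I_B(Π) is
-- the sum of m(2n - m) over the peaks minus the valleys. Summation by parts turns this into
-- the area under the path, which is positive: the path starts with an up step and never goes
-- below zero, as each unbarred copy precedes the barred one.

module Submission where

open import Defs
open import Data.Nat using (ℕ; _≤_)
open import Data.Integer using (+_; _>_)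
open import Data.Fin using (Fin)
open import Data.List using (List)
open import Data.Product using (_×_)

import Data.Nat.Properties as ℕP
import Data.Integer.Properties as ℤP
open import Algebra.Properties.CommutativeMonoid.Sum ℕP.+-0-commutativeMonoid
  using (sum-syntax; ∑-distrib-+; sum-cong-≗; sum-replicate-zero)
open import Data.Bool using (Bool; true; false; if_then_else_; _∨_; _∧_)
open import Data.Bool.Properties using (∧-zeroʳ; ∨-zeroʳ)
open import Data.Empty using (⊥-elim)
open import Data.Fin using (zero; suc)
open import Data.Fin.Properties using (_≟_)
open import Data.Fin.Subset using (Subset; ⁅_⁆; _∪_; _─_; ∣_∣; ⊥)
open import Data.Fin.Subset.Properties using (_∈?_; ∪-comm; ∪-identityʳ)
open import Data.Integer as ℤ using (ℤ; _+_; _-_; -_; _*_)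
open import Data.Integer.Tactic.RingSolver using (solve-∀)
open import Data.List using ([]; _∷_; _++_; length; filter; map; replicate; take; drop)
open import Data.List.Properties
  using (filter-++; length-++; length-map; ++-assoc; take-map; take++drop≡id)
open import Data.Nat as ℕ using (suc; s≤s; z≤n)
open import Data.Product using (_,_; proj₁; proj₂)
open import Data.Vec using ([]; _∷_; lookup)
open import Data.Vec.Properties using (lookup-zipWith; lookup-replicate)
open import Function using (_∘_)
open import Relation.Binary.PropositionalEquality
  using (_≡_; refl; sym; trans; cong; cong₂; subst; module ≡-Reasoning)
open import Relation.Nullary using (¬_; does; yes; no)
open import Relation.Unary using (Pred; Decidable)

sumOver : ∀ {n} → Subset n → (Fin n → ℕ) → ℕ
sumOver {n} P f = ∑[ x < n ] (if lookup P x then f x else 0)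

Disjoint : ∀ {n} → Subset n → Subset n → Set
Disjoint P Q = ∀ x → lookup P x ∧ lookup Q x ≡ false

lookup-∪ : ∀ {n} (P Q : Subset n) x → lookup (P ∪ Q) x ≡ (lookup P x ∨ lookup Q x)
lookup-∪ P Q x = lookup-zipWith _∨_ x P Q

lookup-⁅⁆ : ∀ {n} (i x : Fin n) → lookup ⁅ i ⁆ x ≡ does (x ≟ i)
lookup-⁅⁆ zero    zero    = refl
lookup-⁅⁆ zero    (suc x) = lookup-replicate x false
lookup-⁅⁆ (suc i) zero    = refl
lookup-⁅⁆ (suc i) (suc x) = lookup-⁅⁆ i x

lookup-⁅x⁆-x : ∀ {n} (x : Fin n) → lookup ⁅ x ⁆ x ≡ true
lookup-⁅x⁆-x zero    = refl
lookup-⁅x⁆-x (suc x) = lookup-⁅x⁆-x x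

sumOver-⊥ : ∀ {n} (f : Fin n → ℕ) → sumOver ⊥ f ≡ 0
sumOver-⊥ {n} f = trans (sum-cong-≗ (λ x → cong (λ b → if b then f x else 0) (lookup-replicate x false)))
                        (sum-replicate-zero n)

sumOver-⁅⁆ : ∀ {n} (i : Fin n) (f : Fin n → ℕ) → sumOver ⁅ i ⁆ f ≡ f i
sumOver-⁅⁆ zero    f = trans (cong (f zero ℕ.+_) (sumOver-⊥ (f ∘ suc))) (ℕP.+-identityʳ (f zero))
sumOver-⁅⁆ (suc i) f = sumOver-⁅⁆ i (f ∘ suc)

sumOver-∪ : ∀ {n} {P Q : Subset n} → Disjoint P Q → (f : Fin n → ℕ) →
            sumOver (P ∪ Q) f ≡ sumOver P f ℕ.+ sumOver Q f
sumOver-∪ {P = P} {Q} disj f =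
  trans (sum-cong-≗ (λ x → trans (cong (λ b → if b then f x else 0) (lookup-∪ P Q x))
                                 (split (lookup P x) (lookup Q x) (disj x))))
        (∑-distrib-+ (λ x → if lookup P x then f x else 0) (λ x → if lookup Q x then f x else 0))
  where
  split : ∀ p q {a} → p ∧ q ≡ false →
          (if p ∨ q then a else 0) ≡ (if p then a else 0) ℕ.+ (if q then a else 0)
  split true  false _ = sym (ℕP.+-identityʳ _)
  split false true  _ = refl
  split false false _ = refl

Disjoint-⁅⁆ : ∀ {n} {i j : Fin n} → ¬ i ≡ j → Disjoint ⁅ i ⁆ ⁅ j ⁆
Disjoint-⁅⁆ {i = i} {j} i≢j x rewrite lookup-⁅⁆ i x | lookup-⁅⁆ j x with x ≟ i | x ≟ j
... | yes refl | yes refl = ⊥-elim (i≢j refl)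
... | yes _    | no _     = refl
... | no _     | _        = refl

∑-mono-≤ : ∀ {n} {f g : Fin n → ℕ} → (∀ x → f x ≤ g x) → ∑[ x < n ] f x ≤ ∑[ x < n ] g x
∑-mono-≤ {0}     f≤g = z≤n
∑-mono-≤ {suc n} f≤g = ℕP.+-mono-≤ (f≤g zero) (∑-mono-≤ (f≤g ∘ suc))

weight : ∀ {n} → Subset n → Subset n → ℕ
weight X Y = ∣ X ∣ ℕ.+ ∣ X ─ Y ∣

pointWeight : Bool → Bool → ℕ
pointWeight true  false = 2
pointWeight true  true  = 1
pointWeight false _     = 0

weight-∑ : ∀ {n} (X Y : Subset n) → weight X Y ≡ ∑[ x < n ] pointWeight (lookup X x) (lookup Y x)
weight-∑ []          []          = refl
weight-∑ (true ∷ X)  (true ∷ Y)  = cong suc (weight-∑ X Y)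
weight-∑ (true ∷ X)  (false ∷ Y) = cong suc (trans (ℕP.+-suc _ _) (cong suc (weight-∑ X Y)))
weight-∑ (false ∷ X) (true ∷ Y)  = weight-∑ X Y
weight-∑ (false ∷ X) (false ∷ Y) = weight-∑ X Y

-- gain s t = pointWeight (s ∨ true) t ∸ pointWeight s (t ∨ true): what a point gains by
-- being moved from the second set to the first.
gain : Bool → Bool → ℕ
gain false false = 2
gain false true  = 1
gain true  false = 1
gain true  true  = 0

gain-comm : ∀ s t → gain s t ≡ gain t s
gain-comm false false = refl
gain-comm false true  = refl
gain-comm true  false = refl
gain-comm true  true  = refl

gain-positive : ∀ s t → s ∧ t ≡ false → 1 ≤ gain s t
gain-positive false false _ = s≤s z≤n
gain-positive false true  _ = s≤s z≤n
gain-positive true  false _ = s≤s z≤n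

pointWeight-split : ∀ s t p q → p ∧ q ≡ false →
  pointWeight (s ∨ p) (t ∨ q) ≡ pointWeight s (t ∨ (p ∨ q)) ℕ.+ (if p then gain s t else 0)
pointWeight-split _     _     true  true  ()
pointWeight-split false false true  false _ = refl
pointWeight-split false true  true  false _ = refl
pointWeight-split true  false true  false _ = refl
pointWeight-split true  true  true  false _ = refl
pointWeight-split false false false q     _ = refl
pointWeight-split false true  false q     _ = refl
pointWeight-split true  false false true  _ = refl
pointWeight-split true  false false false _ = refl
pointWeight-split true  true  false q     _ = refl

weight-split : ∀ {n} (S T : Subset n) {P Q : Subset n} → Disjoint P Q →
  weight (S ∪ P) (T ∪ Q)
    ≡ weight S (T ∪ (P ∪ Q)) ℕ.+ sumOver P (λ x → gain (lookup S x) (lookup T x))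
weight-split {n} S T {P} {Q} disj = begin
  weight (S ∪ P) (T ∪ Q)
    ≡⟨ weight-∑ (S ∪ P) (T ∪ Q) ⟩
  ∑[ x < n ] pointWeight (lookup (S ∪ P) x) (lookup (T ∪ Q) x)
    ≡⟨ sum-cong-≗ pointwise ⟩
  ∑[ x < n ] (pointWeight (lookup S x) (lookup (T ∪ (P ∪ Q)) x) ℕ.+ extra x)
    ≡⟨ ∑-distrib-+ (λ x → pointWeight (lookup S x) (lookup (T ∪ (P ∪ Q)) x)) extra ⟩
  ∑[ x < n ] pointWeight (lookup S x) (lookup (T ∪ (P ∪ Q)) x) ℕ.+ sumOver P g
    ≡⟨ cong (ℕ._+ sumOver P g) (sym (weight-∑ S (T ∪ (P ∪ Q)))) ⟩
  weight S (T ∪ (P ∪ Q)) ℕ.+ sumOver P g ∎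
  where
  open ≡-Reasoning
  g : Fin n → ℕ
  g x = gain (lookup S x) (lookup T x)
  extra : Fin n → ℕ
  extra x = if lookup P x then g x else 0
  pointwise : ∀ x → pointWeight (lookup (S ∪ P) x) (lookup (T ∪ Q) x)
                  ≡ pointWeight (lookup S x) (lookup (T ∪ (P ∪ Q)) x) ℕ.+ extra x
  pointwise x rewrite lookup-∪ S P x | lookup-∪ T Q x | lookup-∪ T (P ∪ Q) x | lookup-∪ P Q x =
    pointWeight-split (lookup S x) (lookup T x) (lookup P x) (lookup Q x) (disj x)

weight-split-pair : ∀ {n} {i j : Fin n} → ¬ i ≡ j → ∀ (X Y : Subset n) →
  weight (X ∪ ⁅ i ⁆) (Y ∪ ⁅ j ⁆)
    ≡ weight X (Y ∪ (⁅ i ⁆ ∪ ⁅ j ⁆)) ℕ.+ gain (lookup X i) (lookup Y i)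
weight-split-pair {i = i} {j} i≢j X Y =
  trans (weight-split X Y (Disjoint-⁅⁆ i≢j))
        (cong (weight X (Y ∪ (⁅ i ⁆ ∪ ⁅ j ⁆)) ℕ.+_) (sumOver-⁅⁆ i _))

weight-split-both : ∀ {n} {i j : Fin n} → ¬ i ≡ j → ∀ (X Y : Subset n) →
  weight (X ∪ (⁅ i ⁆ ∪ ⁅ j ⁆)) Y
    ≡ weight X (Y ∪ (⁅ i ⁆ ∪ ⁅ j ⁆))
        ℕ.+ (gain (lookup X i) (lookup Y i) ℕ.+ gain (lookup X j) (lookup Y j))
weight-split-both {n} {i} {j} i≢j X Y = begin
  weight (X ∪ ij) Y
    ≡⟨ cong (weight (X ∪ ij)) (sym (∪-identityʳ Y)) ⟩
  weight (X ∪ ij) (Y ∪ ⊥)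
    ≡⟨ weight-split X Y (λ x → trans (cong (lookup ij x ∧_) (lookup-replicate x false)) (∧-zeroʳ _)) ⟩
  weight X (Y ∪ (ij ∪ ⊥)) ℕ.+ sumOver ij g
    ≡⟨ cong₂ ℕ._+_ (cong (λ Z → weight X (Y ∪ Z)) (∪-identityʳ ij))
                   (sumOver-∪ {P = ⁅ i ⁆} {⁅ j ⁆} (Disjoint-⁅⁆ i≢j) g) ⟩
  weight X (Y ∪ ij) ℕ.+ (sumOver ⁅ i ⁆ g ℕ.+ sumOver ⁅ j ⁆ g)
    ≡⟨ cong (weight X (Y ∪ ij) ℕ.+_) (cong₂ ℕ._+_ (sumOver-⁅⁆ i g) (sumOver-⁅⁆ j g)) ⟩
  weight X (Y ∪ ij) ℕ.+ (g i ℕ.+ g j) ∎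
  where
  open ≡-Reasoning
  ij : Subset n
  ij = ⁅ i ⁆ ∪ ⁅ j ⁆
  g : Fin n → ℕ
  g x = gain (lookup X x) (lookup Y x)

-- Supermodular inequalities

Π-≡ : ∀ {n} (X Y : Subset n) {a b} → weight X Y ≡ a → weight Y X ≡ b → Π X Y ≡ - (+ a * + b)
Π-≡ X Y refl refl = refl

supermodular-arith : ∀ a b gi gj →
  ((- (+ a * + (b ℕ.+ (gi ℕ.+ gj))) + - (+ (a ℕ.+ (gi ℕ.+ gj)) * + b))
    - - (+ (a ℕ.+ gi) * + (b ℕ.+ gj))) - - (+ (a ℕ.+ gj) * + (b ℕ.+ gi))
  ≡ + (2 ℕ.* gi ℕ.* gj)
supermodular-arith a b gi gj =
  identity (+ a) (+ b) (+ gi) (+ gj)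
    (+-+ b (gi ℕ.+ gj) (ℤP.pos-+ gi gj)) (+-+ a (gi ℕ.+ gj) (ℤP.pos-+ gi gj))
    (ℤP.pos-+ a gi) (ℤP.pos-+ b gj) (ℤP.pos-+ a gj) (ℤP.pos-+ b gi)
    (trans (ℤP.pos-* (2 ℕ.* gi) gj) (cong (_* + gj) (ℤP.pos-* 2 gi)))
  where
  +-+ : ∀ m k {z} → + k ≡ z → + (m ℕ.+ k) ≡ + m + z
  +-+ m k refl = ℤP.pos-+ m k
  -- The equations abstract the casts of sums, which the ring solver cannot see through.
  identity : ∀ a b gi gj {B₁ A₂ A₃ B₃ A₄ B₄ K} →
    B₁ ≡ b + (gi + gj) → A₂ ≡ a + (gi + gj) → A₃ ≡ a + gi → B₃ ≡ b + gj →
    A₄ ≡ a + gj → B₄ ≡ b + gi → K ≡ + 2 * gi * gj →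
    ((- (a * B₁) + - (A₂ * b)) - - (A₃ * B₃)) - - (A₄ * B₄) ≡ K
  identity a b gi gj refl refl refl refl refl refl refl = ring a b gi gj
    where
    ring : ∀ a b gi gj →
      ((- (a * (b + (gi + gj))) + - ((a + (gi + gj)) * b)) - - ((a + gi) * (b + gj)))
        - - ((a + gj) * (b + gi))
      ≡ + 2 * gi * gj
    ring = solve-∀

I-sm-Π : ∀ {n} (S T : Subset n) {i j : Fin n} → ¬ i ≡ j →
  ((Π S (T ∪ (⁅ i ⁆ ∪ ⁅ j ⁆)) + Π (S ∪ (⁅ i ⁆ ∪ ⁅ j ⁆)) T)
    - Π (S ∪ ⁅ i ⁆) (T ∪ ⁅ j ⁆)) - Π (S ∪ ⁅ j ⁆) (T ∪ ⁅ i ⁆)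
  ≡ + (2 ℕ.* gain (lookup S i) (lookup T i) ℕ.* gain (lookup S j) (lookup T j))
I-sm-Π {n} S T {i} {j} i≢j =
  trans (cong₂ _-_ (cong₂ _-_ (cong₂ _+_ (Π-≡ S (T ∪ ij) refl T-both)
                                         (Π-≡ (S ∪ ij) T (weight-split-both i≢j S T) refl))
                              (Π-≡ (S ∪ ⁅ i ⁆) (T ∪ ⁅ j ⁆) (weight-split-pair i≢j S T) T-ji))
                   (Π-≡ (S ∪ ⁅ j ⁆) (T ∪ ⁅ i ⁆) S-ji T-ij))
        (supermodular-arith A B Gi Gj)
  where
  ij : Subset n
  ij = ⁅ i ⁆ ∪ ⁅ j ⁆
  A B Gi Gj : ℕ
  A = weight S (T ∪ ij)
  B = weight T (S ∪ ij)
  Gi = gain (lookup S i) (lookup T i)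
  Gj = gain (lookup S j) (lookup T j)
  j≢i : ¬ j ≡ i
  j≢i = i≢j ∘ sym
  Gi-comm : gain (lookup T i) (lookup S i) ≡ Gi
  Gi-comm = gain-comm (lookup T i) (lookup S i)
  Gj-comm : gain (lookup T j) (lookup S j) ≡ Gj
  Gj-comm = gain-comm (lookup T j) (lookup S j)
  T-both : weight (T ∪ ij) S ≡ B ℕ.+ (Gi ℕ.+ Gj)
  T-both = trans (weight-split-both i≢j T S) (cong (B ℕ.+_) (cong₂ ℕ._+_ Gi-comm Gj-comm))
  T-ij : weight (T ∪ ⁅ i ⁆) (S ∪ ⁅ j ⁆) ≡ B ℕ.+ Gi
  T-ij = trans (weight-split-pair i≢j T S) (cong (B ℕ.+_) Gi-comm)
  T-ji : weight (T ∪ ⁅ j ⁆) (S ∪ ⁅ i ⁆) ≡ B ℕ.+ Gj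
  T-ji = trans (weight-split-pair j≢i T S)
               (cong₂ ℕ._+_ (cong (λ Z → weight T (S ∪ Z)) (∪-comm ⁅ j ⁆ ⁅ i ⁆)) Gj-comm)
  S-ji : weight (S ∪ ⁅ j ⁆) (T ∪ ⁅ i ⁆) ≡ A ℕ.+ Gj
  S-ji = trans (weight-split-pair j≢i S T)
               (cong (λ Z → weight S (T ∪ Z) ℕ.+ Gj) (∪-comm ⁅ j ⁆ ⁅ i ⁆))

length-filter-∷ : ∀ {a p} {A : Set a} {P : Pred A p} (P? : Decidable P) y ys →
  length (filter P? (y ∷ ys))
    ≡ (if does (P? y) then suc (length (filter P? ys)) else length (filter P? ys))
length-filter-∷ P? y ys with does (P? y)
... | true  = refl
... | false = refl

length-filter-++ : ∀ {a p} {A : Set a} {P : Pred A p} (P? : Decidable P) xs ys →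
  length (filter P? (xs ++ ys)) ≡ length (filter P? xs) ℕ.+ length (filter P? ys)
length-filter-++ P? xs ys = trans (cong length (filter-++ P? xs ys)) (length-++ (filter P? xs))

does-∈ : ∀ {n} (x : Fin n) (P : Subset n) → does (x ∈? P) ≡ lookup P x
does-∈ zero    (true ∷ P)  = refl
does-∈ zero    (false ∷ P) = refl
does-∈ (suc x) (b ∷ P)     = does-∈ x P

occ-∷ : ∀ {n} (x : Fin n) P Ps → occ x (P ∷ Ps) ≡ (if lookup P x then suc (occ x Ps) else occ x Ps)
occ-∷ x P Ps = trans (length-filter-∷ (x ∈?_) P Ps)
                     (cong (λ b → if b then suc (occ x Ps) else occ x Ps) (does-∈ x P))

count-∷ : ∀ {n} (x y : Fin n) L →
  count x (y ∷ L) ≡ (if lookup ⁅ y ⁆ x then suc (count x L) else count x L)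
count-∷ x y L = trans (length-filter-∷ (x ≟_) y L)
                      (cong (λ b → if b then suc (count x L) else count x L) (sym (lookup-⁅⁆ y x)))

occ-singletons : ∀ {n} (x : Fin n) L → occ x (map ⁅_⁆ L) ≡ count x L
occ-singletons x []      = refl
occ-singletons x (y ∷ L) =
  trans (occ-∷ x ⁅ y ⁆ (map ⁅_⁆ L))
        (trans (cong (λ k → if lookup ⁅ y ⁆ x then suc k else k) (occ-singletons x L))
               (sym (count-∷ x y L)))

lookup-setOf : ∀ {n} (x : Fin n) L → lookup (setOf L) x ≡ (0 ℕ.<ᵇ count x L)
lookup-setOf x []      = lookup-replicate x false
lookup-setOf x (y ∷ L) rewrite lookup-∪ ⁅ y ⁆ (setOf L) x | count-∷ x y L with lookup ⁅ y ⁆ x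
... | true  = refl
... | false = lookup-setOf x L

-- An element of the part {i,j} lies in no other part, hence not in both S and T.
pairElement-gain : ∀ {n} L₁ (i j : Fin n) L₂ x → lookup (⁅ i ⁆ ∪ ⁅ j ⁆) x ≡ true →
  occ x (smParts L₁ i j L₂) ≤ 2 → 1 ≤ gain (lookup (setOf L₁) x) (lookup (setOf L₂) x)
pairElement-gain L₁ i j L₂ x x∈ij occ≤2 rewrite lookup-setOf x L₁ | lookup-setOf x L₂ =
  gain-positive _ _ (notBoth (count x L₁) (count x L₂) (subst (ℕ._≤ 2) occ≡ occ≤2))
  where
  occ≡ : occ x (smParts L₁ i j L₂) ≡ count x L₁ ℕ.+ suc (count x L₂)
  occ≡ rewrite length-filter-++ (x ∈?_) (map ⁅_⁆ L₁) ((⁅ i ⁆ ∪ ⁅ j ⁆) ∷ map ⁅_⁆ L₂)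
             | occ-∷ x (⁅ i ⁆ ∪ ⁅ j ⁆) (map ⁅_⁆ L₂) | x∈ij
             | occ-singletons x L₁ | occ-singletons x L₂ = refl
  notBoth : ∀ a b → a ℕ.+ suc b ≤ 2 → (0 ℕ.<ᵇ a) ∧ (0 ℕ.<ᵇ b) ≡ false
  notBoth 0       b       _  = refl
  notBoth (suc a) 0       _  = refl
  notBoth (suc a) (suc b) le with ℕP.m+n≤o⇒n≤o a (ℕP.≤-pred le)
  ... | s≤s ()

supermodular-positive : ∀ {n} L₁ (i j : Fin n) L₂ →
  IsSupermodularB n L₁ i j L₂ → I-sm Π L₁ i j L₂ > + 0
supermodular-positive L₁ i j L₂ (i≢j , (_ , occ-bounds , _) , _) =
  subst (+ 0 ℤ.<_) (sym (I-sm-Π (setOf L₁) (setOf L₂) i≢j))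
        (ℤ.+<+ (ℕP.*-mono-≤ (ℕP.≤-trans Gi-positive (ℕP.m≤m+n _ _)) Gj-positive))
  where
  i∈ij : lookup (⁅ i ⁆ ∪ ⁅ j ⁆) i ≡ true
  i∈ij = trans (lookup-∪ ⁅ i ⁆ ⁅ j ⁆ i) (cong (_∨ lookup ⁅ j ⁆ i) (lookup-⁅x⁆-x i))
  j∈ij : lookup (⁅ i ⁆ ∪ ⁅ j ⁆) j ≡ true
  j∈ij = trans (lookup-∪ ⁅ i ⁆ ⁅ j ⁆ j)
               (trans (cong (lookup ⁅ i ⁆ j ∨_) (lookup-⁅x⁆-x j)) (∨-zeroʳ (lookup ⁅ i ⁆ j)))
  Gi-positive : 1 ≤ gain (lookup (setOf L₁) i) (lookup (setOf L₂) i)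
  Gi-positive = pairElement-gain L₁ i j L₂ i i∈ij (proj₂ (occ-bounds i))
  Gj-positive : 1 ≤ gain (lookup (setOf L₁) j) (lookup (setOf L₂) j)
  Gj-positive = pairElement-gain L₁ i j L₂ j j∈ij (proj₂ (occ-bounds j))

-- The barred sequence

marks : ∀ {n} → Fin n → List (Fin n × Bool) → List Bool
marks x []            = []
marks x ((y , b) ∷ P) = if does (x ≟ y) then b ∷ marks x P else marks x P

marks-++ : ∀ {n} (x : Fin n) P Q → marks x (P ++ Q) ≡ marks x P ++ marks x Q
marks-++ x []            Q = refl
marks-++ x ((y , b) ∷ P) Q with does (x ≟ y)
... | true  = cong (b ∷_) (marks-++ x P Q)
... | false = marks-++ x P Q

pairs : ℕ → List Bool
pairs 0       = []
pairs (suc k) = false ∷ true ∷ pairs k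

marks-expand-once : ∀ {n} (c : List (Fin n)) {x} → count x c ≡ 1 → ∀ seen xs →
  marks x (expand c seen xs) ≡ pairs (count x xs)
marks-expand-once c     once seen []       = refl
marks-expand-once c {x} once seen (y ∷ ys) with count y c ℕ.≟ 1
... | yes _ with x ≟ y
...   | yes refl = cong (λ bs → false ∷ true ∷ bs) (marks-expand-once c once (y ∷ seen) ys)
...   | no _     = marks-expand-once c once (y ∷ seen) ys
marks-expand-once c {x} once seen (y ∷ ys) | no twice with x ≟ y
...   | yes refl = ⊥-elim (twice once)
...   | no _     = marks-expand-once c once (y ∷ seen) ys

-- Marks of the remaining k occurrences of a twice occurring x: the first is barred iff x
-- has been seen.
later : Bool → ℕ → List Bool
later s 0       = []
later s (suc k) = s ∷ replicate k true

elem-≢ : ∀ {n} {x y : Fin n} → ¬ x ≡ y → ∀ seen → elem x (y ∷ seen) ≡ elem x seen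
elem-≢ {x = x} {y} x≢y seen with x ≟ y
... | yes x≡y = ⊥-elim (x≢y x≡y)
... | no _    = refl

marks-expand-twice : ∀ {n} (c : List (Fin n)) {x} → ¬ count x c ≡ 1 → ∀ seen xs →
  marks x (expand c seen xs) ≡ later (elem x seen) (count x xs)
marks-expand-twice c     ¬once seen []       = refl
marks-expand-twice c {x} ¬once seen (y ∷ ys) with count y c ℕ.≟ 1
... | yes once with x ≟ y
...   | yes refl = ⊥-elim (¬once once)
...   | no x≢y   = trans (marks-expand-twice c ¬once (y ∷ seen) ys)
                       (cong (λ s → later s (count x ys)) (elem-≢ x≢y seen))
marks-expand-twice c {x} ¬once seen (y ∷ ys) | no _ with x ≟ y
...   | yes refl = cong (elem x seen ∷_) (trans (marks-expand-twice c ¬once (x ∷ seen) ys)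
                                                (seen-later (count x ys)))
  where
  seen-later : ∀ k → later (elem x (x ∷ seen)) k ≡ replicate k true
  seen-later 0       = refl
  seen-later (suc k) with x ≟ x
  ... | yes _   = refl
  ... | no x≢x = ⊥-elim (x≢x refl)
...   | no x≢y   = trans (marks-expand-twice c ¬once (y ∷ seen) ys)
                       (cong (λ s → later s (count x ys)) (elem-≢ x≢y seen))

barSeq-marks : ∀ {n} (c : List (Fin n)) x → 1 ≤ count x c → count x c ≤ 2 →
  marks x (barSeq c) ≡ false ∷ true ∷ []
barSeq-marks c x 1≤ ≤2 with count x c ℕ.≟ 1
... | yes once = trans (marks-expand-once c once [] c) (cong pairs once)
... | no ¬once = trans (marks-expand-twice c ¬once [] c) (cong (later false) (two 1≤ ≤2 ¬once))
  where
  two : ∀ {k} → 1 ≤ k → k ≤ 2 → ¬ k ≡ 1 → k ≡ 2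
  two (s≤s z≤n) (s≤s z≤n)       ¬k≡1 = ⊥-elim (¬k≡1 refl)
  two (s≤s z≤n) (s≤s (s≤s z≤n)) _    = refl

Paired : ∀ {n} → List (Fin n × Bool) → Set
Paired β = ∀ x → marks x β ≡ false ∷ true ∷ []

flags : ∀ {n} → List (Fin n × Bool) → List Bool
flags = map proj₂

tally : (Bool → ℕ) → List Bool → ℕ
tally g []       = 0
tally g (b ∷ bs) = g b ℕ.+ tally g bs

∑-tally-marks : ∀ {n} (g : Bool → ℕ) (P : List (Fin n × Bool)) →
  ∑[ x < n ] tally g (marks x P) ≡ tally g (flags P)
∑-tally-marks {n} g []            = sum-replicate-zero n
∑-tally-marks {n} g ((y , b) ∷ P) = begin
  ∑[ x < n ] tally g (marks x ((y , b) ∷ P))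
    ≡⟨ sum-cong-≗ head-split ⟩
  ∑[ x < n ] ((if lookup ⁅ y ⁆ x then g b else 0) ℕ.+ tally g (marks x P))
    ≡⟨ ∑-distrib-+ (λ x → if lookup ⁅ y ⁆ x then g b else 0) (λ x → tally g (marks x P)) ⟩
  sumOver ⁅ y ⁆ (λ _ → g b) ℕ.+ ∑[ x < n ] tally g (marks x P)
    ≡⟨ cong₂ ℕ._+_ (sumOver-⁅⁆ y (λ _ → g b)) (∑-tally-marks g P) ⟩
  g b ℕ.+ tally g (flags P) ∎
  where
  open ≡-Reasoning
  head-split : ∀ x → tally g (marks x ((y , b) ∷ P))
                   ≡ (if lookup ⁅ y ⁆ x then g b else 0) ℕ.+ tally g (marks x P)
  head-split x rewrite lookup-⁅⁆ y x with does (x ≟ y)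
  ... | true  = refl
  ... | false = refl

tally-length : ∀ bs → tally (λ _ → 1) bs ≡ length bs
tally-length []       = refl
tally-length (b ∷ bs) = cong suc (tally-length bs)

∑-length-marks : ∀ {n} (P : List (Fin n × Bool)) → ∑[ x < n ] length (marks x P) ≡ length P
∑-length-marks {n} P = begin
  ∑[ x < n ] length (marks x P)          ≡⟨ sum-cong-≗ (λ x → sym (tally-length (marks x P))) ⟩
  ∑[ x < n ] tally (λ _ → 1) (marks x P) ≡⟨ ∑-tally-marks (λ _ → 1) P ⟩
  tally (λ _ → 1) (flags P)              ≡⟨ tally-length (flags P) ⟩
  length (flags P)                       ≡⟨ length-map proj₂ P ⟩
  length P                               ∎
  where open ≡-Reasoning

count-elems : ∀ {n} (x : Fin n) P → count x (elems P) ≡ length (marks x P)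
count-elems x []            = refl
count-elems x ((y , b) ∷ P) with x ≟ y
... | yes _ = cong suc (count-elems x P)
... | no _  = count-elems x P

pointWeight-occupancy : ∀ a b → a ℕ.+ b ≡ 2 → pointWeight (0 ℕ.<ᵇ a) (0 ℕ.<ᵇ b) ≡ a
pointWeight-occupancy 0                   _             _  = refl
pointWeight-occupancy 1                   0             ()
pointWeight-occupancy 1                   1             _  = refl
pointWeight-occupancy 1                   (suc (suc b)) ()
pointWeight-occupancy 2                   0             _  = refl
pointWeight-occupancy 2                   (suc b)       ()
pointWeight-occupancy (suc (suc (suc a))) b             ()

-- An element with k of its two entries in P contributes pointWeight k.
weight-split-entries : ∀ {n} (P Q : List (Fin n × Bool)) →
  (∀ x → length (marks x P) ℕ.+ length (marks x Q) ≡ 2) →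
  weight (setOf (elems P)) (setOf (elems Q)) ≡ length P
weight-split-entries {n} P Q twice = begin
  weight (setOf (elems P)) (setOf (elems Q))
    ≡⟨ weight-∑ (setOf (elems P)) (setOf (elems Q)) ⟩
  ∑[ x < n ] pointWeight (lookup (setOf (elems P)) x) (lookup (setOf (elems Q)) x)
    ≡⟨ sum-cong-≗ pointwise ⟩
  ∑[ x < n ] length (marks x P)
    ≡⟨ ∑-length-marks P ⟩
  length P ∎
  where
  open ≡-Reasoning
  pointwise : ∀ x → pointWeight (lookup (setOf (elems P)) x) (lookup (setOf (elems Q)) x)
                  ≡ length (marks x P)
  pointwise x rewrite lookup-setOf x (elems P) | lookup-setOf x (elems Q)
                    | count-elems x P | count-elems x Q =
    pointWeight-occupancy (length (marks x P)) (length (marks x Q)) (twice x)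

-- Up-down inequalities as areas under lattice paths

turn : Bool → Bool → ℤ
turn false true  = + 1
turn true  false = - + 1
turn _     _     = + 0

turnSum : ℕ → List Bool → ℤ
turnSum m []           = + 0
turnSum m (a ∷ [])     = + 0
turnSum m (a ∷ b ∷ bs) = turn a b * (+ suc m * + length (b ∷ bs)) + turnSum (suc m) (b ∷ bs)

contrib-Π : ∀ {n} a b (X Y : Subset n) → contrib Π a b X Y ≡ turn a b * (+ weight X Y * + weight Y X)
contrib-Π false true  X Y = trans (ℤP.neg-involutive _) (sym (ℤP.*-identityˡ _))
contrib-Π true  false X Y = sym (ℤP.-1*i≡-i _)
contrib-Π false false X Y = refl
contrib-Π true  true  X Y = refl

udSum-Π : ∀ {n} (pre cur : List (Fin n × Bool)) → (∀ x → length (marks x (pre ++ cur)) ≡ 2) →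
  udSum Π pre cur ≡ turnSum (length pre) (flags cur)
udSum-Π pre []                            _     = refl
udSum-Π pre (_ ∷ [])                      _     = refl
udSum-Π pre ((x , a) ∷ (y , b) ∷ rest) twice =
  cong₂ _+_ (trans (contrib-Π a b (setOf (elems P)) (setOf (elems Q)))
                   (cong (turn a b *_) (cong₂ (λ k l → + k * + l)
                     (trans (weight-split-entries P Q splitP) length-P)
                     (trans (weight-split-entries Q P splitQ) (sym (length-map proj₂ Q))))))
            (trans (udSum-Π P ((y , b) ∷ rest) twice′) (cong (λ k → turnSum k (flags Q)) length-P))
  where
  P Q : List _
  P = pre ++ (x , a) ∷ []
  Q = (y , b) ∷ rest
  twice′ : ∀ z → length (marks z (P ++ Q)) ≡ 2
  twice′ z = trans (cong (length ∘ marks z) (++-assoc pre ((x , a) ∷ []) Q)) (twice z)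
  splitP : ∀ z → length (marks z P) ℕ.+ length (marks z Q) ≡ 2
  splitP z = trans (sym (length-++ (marks z P))) (trans (cong length (sym (marks-++ z P Q))) (twice′ z))
  splitQ : ∀ z → length (marks z Q) ℕ.+ length (marks z P) ≡ 2
  splitQ z = trans (ℕP.+-comm (length (marks z Q)) (length (marks z P))) (splitP z)
  length-P : length P ≡ suc (length pre)
  length-P = trans (length-++ pre) (ℕP.+-comm (length pre) 1)

step : Bool → ℤ
step false = + 1
step true  = - + 1

height : List Bool → ℤ
height []       = + 0
height (b ∷ bs) = step b + height bs

area : ℤ → List Bool → ℤ
area h []       = + 0
area h (b ∷ bs) = (h + step b) + area (h + step b) bs

turn-step : ∀ a b → + 2 * turn a b ≡ step a - step b
turn-step false false = refl
turn-step false true  = refl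
turn-step true  false = refl
turn-step true  true  = refl

turnSum-area-step : ∀ t sa sb T A H h M R → + 2 * t ≡ sa - sb →
  + 2 * T + ((h + sa) + H) * ((+ 1 + M) + R + + 2) + (h + sa) * (R - (+ 1 + M))
    ≡ + 2 * A + sb * ((+ 1 + M) * (R + + 1)) →
  + 2 * (t * ((+ 1 + M) * (+ 1 + R)) + T) + (h + (sa + H)) * (M + (+ 1 + R) + + 2)
    + h * ((+ 1 + R) - M)
    ≡ + 2 * ((h + sa) + A) + sa * (M * ((+ 1 + R) + + 1))
turnSum-area-step t sa sb T A H h M R twice-turn hyp = begin
  + 2 * (t * ((+ 1 + M) * (+ 1 + R)) + T) + (h + (sa + H)) * (M + (+ 1 + R) + + 2)
    + h * ((+ 1 + R) - M)
    ≡⟨ regroup t sa T H h M R ⟩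
  + 2 * t * ((+ 1 + M) * (+ 1 + R))
    + (+ 2 * T + ((h + sa) + H) * ((+ 1 + M) + R + + 2) + (h + sa) * (R - (+ 1 + M)))
    + (+ 2 * h - sa * (R - (+ 1 + M)))
    ≡⟨ cong₂ (λ u v → u * ((+ 1 + M) * (+ 1 + R)) + v + (+ 2 * h - sa * (R - (+ 1 + M))))
             twice-turn hyp ⟩
  (sa - sb) * ((+ 1 + M) * (+ 1 + R)) + (+ 2 * A + sb * ((+ 1 + M) * (R + + 1)))
    + (+ 2 * h - sa * (R - (+ 1 + M)))
    ≡⟨ collect sa sb A h M R ⟩
  + 2 * ((h + sa) + A) + sa * (M * ((+ 1 + R) + + 1)) ∎
  where
  open ≡-Reasoning
  regroup : ∀ t sa T H h M R →
    + 2 * (t * ((+ 1 + M) * (+ 1 + R)) + T) + (h + (sa + H)) * (M + (+ 1 + R) + + 2)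
      + h * ((+ 1 + R) - M)
    ≡ + 2 * t * ((+ 1 + M) * (+ 1 + R))
      + (+ 2 * T + ((h + sa) + H) * ((+ 1 + M) + R + + 2) + (h + sa) * (R - (+ 1 + M)))
      + (+ 2 * h - sa * (R - (+ 1 + M)))
  regroup = solve-∀
  collect : ∀ sa sb A h M R →
    (sa - sb) * ((+ 1 + M) * (+ 1 + R)) + (+ 2 * A + sb * ((+ 1 + M) * (R + + 1)))
      + (+ 2 * h - sa * (R - (+ 1 + M)))
    ≡ + 2 * ((h + sa) + A) + sa * (M * ((+ 1 + R) + + 1))
  collect = solve-∀

-- Summation by parts, twice: 2 turn a b = step a - step b, and m (L - m) has second
-- difference -2, so the weighted turns of a path that starts at height h after m steps add up
-- to its area, up to the boundary terms below (L = m + length (a ∷ r)).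
turnSum-area : ∀ m h a r →
  + 2 * turnSum m (a ∷ r) + (h + height (a ∷ r)) * (+ m + + length r + + 2) + h * (+ length r - + m)
    ≡ + 2 * area h (a ∷ r) + step a * (+ m * (+ length r + + 1))
turnSum-area m h a []      = base h (step a) (+ m)
  where
  base : ∀ h s M → + 2 * + 0 + (h + (s + + 0)) * (M + + 0 + + 2) + h * (+ 0 - M)
                   ≡ + 2 * ((h + s) + + 0) + s * (M * (+ 0 + + 1))
  base = solve-∀
turnSum-area m h a (b ∷ r) =
  turnSum-area-step (turn a b) (step a) (step b) (turnSum (suc m) (b ∷ r)) (area (h + step a) (b ∷ r))
                    (height (b ∷ r)) h (+ m) (+ length r)
                    (turn-step a b) (turnSum-area (suc m) (h + step a) b r)

turnSum≡area : ∀ bs → height bs ≡ + 0 → turnSum 0 bs ≡ area (+ 0) bs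
turnSum≡area []      _    = refl
turnSum≡area (a ∷ r) flat = ℤP.*-cancelˡ-≡ (+ 2) (turnSum 0 (a ∷ r)) (area (+ 0) (a ∷ r)) (begin
  + 2 * turnSum 0 (a ∷ r)
    ≡⟨ add-zeros (turnSum 0 (a ∷ r)) (+ 0 + + length r + + 2) (+ length r - + 0) ⟩
  + 2 * turnSum 0 (a ∷ r) + (+ 0 + + 0) * (+ 0 + + length r + + 2) + + 0 * (+ length r - + 0)
    ≡⟨ cong (λ H → + 2 * turnSum 0 (a ∷ r) + (+ 0 + H) * (+ 0 + + length r + + 2)
                   + + 0 * (+ length r - + 0)) (sym flat) ⟩
  + 2 * turnSum 0 (a ∷ r) + (+ 0 + height (a ∷ r)) * (+ 0 + + length r + + 2)
    + + 0 * (+ length r - + 0)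
    ≡⟨ turnSum-area 0 (+ 0) a r ⟩
  + 2 * area (+ 0) (a ∷ r) + step a * (+ 0 * (+ length r + + 1))
    ≡⟨ drop-zero (area (+ 0) (a ∷ r)) (step a) (+ length r + + 1) ⟩
  + 2 * area (+ 0) (a ∷ r) ∎)
  where
  open ≡-Reasoning
  add-zeros : ∀ T X Y → + 2 * T ≡ + 2 * T + (+ 0 + + 0) * X + + 0 * Y
  add-zeros = solve-∀
  drop-zero : ∀ A s Z → + 2 * A + s * (+ 0 * Z) ≡ + 2 * A
  drop-zero = solve-∀

area-nonneg : ∀ h bs → (∀ k → + 0 ℤ.≤ h + height (take k bs)) → + 0 ℤ.≤ area h bs
area-nonneg h []       _     = ℤP.≤-refl
area-nonneg h (b ∷ bs) above = ℤP.+-mono-≤ first (area-nonneg (h + step b) bs rest)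
  where
  first : + 0 ℤ.≤ h + step b
  first = subst (+ 0 ℤ.≤_) (cong (λ s → h + s) (ℤP.+-identityʳ (step b))) (above 1)
  rest : ∀ k → + 0 ℤ.≤ (h + step b) + height (take k bs)
  rest k = subst (+ 0 ℤ.≤_) (sym (ℤP.+-assoc h (step b) (height (take k bs)))) (above (suc k))

area-positive : ∀ bs → (∀ k → + 0 ℤ.≤ height (take k (false ∷ bs))) → + 0 ℤ.< area (+ 0) (false ∷ bs)
area-positive bs above = ℤP.+-mono-<-≤ (ℤ.+<+ (s≤s z≤n)) (area-nonneg (+ 1) bs (above ∘ suc))

isUp isDown : Bool → ℕ
isUp   false = 1
isUp   true  = 0
isDown false = 0
isDown true  = 1

height-tally : ∀ bs → height bs ≡ + tally isUp bs - + tally isDown bs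
height-tally []           = refl
height-tally (false ∷ bs) =
  trans (cong (λ v → + 1 + v) (height-tally bs)) (up (+ tally isUp bs) (+ tally isDown bs))
  where
  up : ∀ u d → + 1 + (u - d) ≡ (+ 1 + u) - d
  up = solve-∀
height-tally (true ∷ bs) =
  trans (cong (λ v → - + 1 + v) (height-tally bs)) (down (+ tally isUp bs) (+ tally isDown bs))
  where
  down : ∀ u d → - + 1 + (u - d) ≡ u - (+ 1 + d)
  down = solve-∀

prefix-downs≤ups : ∀ A B → A ++ B ≡ false ∷ true ∷ [] → tally isDown A ≤ tally isUp A
prefix-downs≤ups []                     _ _  = z≤n
prefix-downs≤ups (false ∷ [])           _ _  = z≤n
prefix-downs≤ups (false ∷ true ∷ [])    _ _  = s≤s z≤n
prefix-downs≤ups (true ∷ _)             _ ()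
prefix-downs≤ups (false ∷ false ∷ _)    _ ()
prefix-downs≤ups (false ∷ true ∷ _ ∷ _) _ ()

Paired-height-prefix : ∀ {n} (β : List (Fin n × Bool)) → Paired β →
  ∀ k → + 0 ℤ.≤ height (take k (flags β))
Paired-height-prefix {n} β paired k
  rewrite take-map {f = proj₂} k β | height-tally (flags (take k β)) =
  ℤP.i≤j⇒0≤j-i (ℤ.+≤+ (begin
    tally isDown (flags (take k β))         ≡⟨ ∑-tally-marks isDown (take k β) ⟨
    ∑[ x < n ] tally isDown (marks x (take k β))
      ≤⟨ ∑-mono-≤ (λ x → prefix-downs≤ups (marks x (take k β)) (marks x (drop k β)) (split x)) ⟩
    ∑[ x < n ] tally isUp (marks x (take k β)) ≡⟨ ∑-tally-marks isUp (take k β) ⟩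
    tally isUp (flags (take k β))           ∎))
  where
  open ℕP.≤-Reasoning
  split : ∀ x → marks x (take k β) ++ marks x (drop k β) ≡ false ∷ true ∷ []
  split x = trans (sym (marks-++ x (take k β) (drop k β)))
                  (trans (cong (marks x) (take++drop≡id k β)) (paired x))

Paired-height : ∀ {n} (β : List (Fin n × Bool)) → Paired β → height (flags β) ≡ + 0
Paired-height {n} β paired =
  trans (height-tally (flags β))
        (trans (cong (λ u → + u - + tally isDown (flags β)) ups≡downs)
               (ℤP.+-inverseʳ (+ tally isDown (flags β))))
  where
  ups≡downs : tally isUp (flags β) ≡ tally isDown (flags β)
  ups≡downs = trans (sym (∑-tally-marks isUp β))
                (trans (sum-cong-≗ (λ x → trans (cong (tally isUp) (paired x))
                                                (sym (cong (tally isDown) (paired x)))))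
                       (∑-tally-marks isDown β))

Paired-area : ∀ {n} (β : List (Fin (suc n) × Bool)) → Paired β → + 0 ℤ.< area (+ 0) (flags β)
Paired-area [] paired with paired zero
... | ()
Paired-area ((y , false) ∷ β) paired =
  area-positive (flags β) (Paired-height-prefix ((y , false) ∷ β) paired)
Paired-area ((y , true) ∷ β)  paired with y ≟ y | paired y
... | yes _   | ()
... | no y≢y | _ = ⊥-elim (y≢y refl)

updown-positive : ∀ n → 2 ≤ n → (c : List (Fin n)) → IsUpDownB n c → I-ud Π c > + 0
updown-positive (suc n) _ c ((_ , occ-bounds , _) , _) =
  subst (+ 0 ℤ.<_) (sym I≡area) (Paired-area (barSeq c) paired)
  where
  paired : Paired (barSeq c)
  paired x = barSeq-marks c x (subst (1 ≤_) (occ-singletons x c) (proj₁ (occ-bounds x)))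
                              (subst (_≤ 2) (occ-singletons x c) (proj₂ (occ-bounds x)))
  I≡area : I-ud Π c ≡ area (+ 0) (flags (barSeq c))
  I≡area = trans (udSum-Π [] (barSeq c) (λ x → cong length (paired x)))
                 (turnSum≡area (flags (barSeq c)) (Paired-height (barSeq c) paired))

proposition9p1 : (n : ℕ) → 2 ≤ n →
    ((L₁ : List (Fin n)) (i j : Fin n) (L₂ : List (Fin n)) →
      IsSupermodularB n L₁ i j L₂ → I-sm Π L₁ i j L₂ > + 0)
    × ((c : List (Fin n)) → IsUpDownB n c → I-ud Π c > + 0)
proposition9p1 n 2≤n = supermodular-positive , updown-positive n 2≤n
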